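{- Let $\mathcal{C} = (E, \mathcal{A}, \pi, \mathit{ok}, \vdash, \Vdash)$ be a contract. If $C$ and $D$ are configurations of $\mathcal{C}$, then $C \cup D$ is a configuration of $\mathcal{C}$.
   Context: A contract is a 6-tuple $\mathcal{C} = (E, \mathcal{A}, \pi, \mathit{ok}, \vdash, \Vdash)$ where $E$ is a finite set of events, $\mathcal{A}$ is a finite set of participants, $\pi : E \to \mathcal{A}$, $\mathit{ok} \subseteq \mathcal{A} \times \mathcal{P}(E)$ satisfies $\mathit{ok}(A,X) \wedge X \subseteq Y \Rightarrow \mathit{ok}(A,Y)$, and $\vdash, \Vdash \subseteq \mathcal{P}(E) \times E$ (the enabling and circular enabling relations) are saturated: $X \circ e$ and $X \subseteq Y$ imply $Y \circ e$ for $\circ \in \{\vdash, \Vdash\}$. A set $C \subseteq E$ is a configuration of $\mathcal{C}$ iff there exist $e_0, \ldots, e_n$ with $\{e_0,\ldots,e_n\} = C$ such that for every $i \le n$, either $\{e_0,\ldots,e_{i-1}\} \vdash e_i$ or $C \Vdash e_i$. (The empty set is a configuration.) -}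

module Defs where

open import Level using (Level; _⊔_; suc)
open import Data.Nat using (ℕ)
open import Data.Fin using (Fin)
open import Data.Fin.Subset using (Subset; _∈_; _⊆_; _∪_; ⁅_⁆; ⊥)
open import Data.List using (List; []; _∷_; _++_; [_])
import Data.List.Membership.Propositional as LM
open import Function.Bundles using (_⇔_)

-- A contract with event set E = Fin n and participant set 𝒜 = Fin m.
-- Sets of events are (finite, decidable) subsets of Fin n.
record Contract (n m : ℕ) : Set₁ where
  field
    π      : Fin n → Fin m
    ok     : Fin m → Subset n → Set
    ok-mono : ∀ {A X Y} → ok A X → X ⊆ Y → ok A Y
    _⊢_    : Subset n → Fin n → Set
    _⊩_    : Subset n → Fin n → Set
    ⊢-sat  : ∀ {X Y e} → X ⊢ e → X ⊆ Y → Y ⊢ e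
    ⊩-sat  : ∀ {X Y e} → X ⊩ e → X ⊆ Y → Y ⊩ e

setOf : ∀ {n} → List (Fin n) → Subset n
setOf []       = ⊥
setOf (e ∷ es) = ⁅ e ⁆ ∪ setOf es

module _ {n m : ℕ} (𝒞 : Contract n m) where
  open Contract 𝒞

  -- every event of the sequence is enabled, given the prefix before it
  -- (processed here via the reversed prefix as an accumulator):
  -- for each i, either {e_0..e_{i-1}} ⊢ e_i or C ⊩ e_i.
  ValidFrom : Subset n → List (Fin n) → Subset n → Set
  ValidFrom C []       prefix = Data.Unit.⊤
    where import Data.Unit
  ValidFrom C (e ∷ es) prefix =
    ((prefix ⊢ e) ⊎ (C ⊩ e)) × ValidFrom C es (⁅ e ⁆ ∪ prefix)
    where open import Data.Sum using (_⊎_)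
          open import Data.Product using (_×_)

  IsConfiguration : Subset n → Set
  IsConfiguration C =
    Σ (List (Fin n)) λ es → (∀ e → (e LM.∈ es) ⇔ (e ∈ C)) × ValidFrom C es ⊥
    where open import Data.Product using (Σ; _×_)

-- Proof idea: if the sequence es witnesses that C is a configuration and ds
-- witnesses it for D, then the concatenation es ++ ds witnesses it for C ∪ D.
--   * Its elements are exactly those of C ∪ D (list membership in a
--     concatenation is a disjunction, and so is membership in a union).
--   * Each event stays enabled: the enabling relations are saturated, so
--     enabledness survives enlarging both the prefix of already fired events
--     and the target set (C, resp. D, grows to C ∪ D).  The events of ds are
--     enabled by their prefix within ds alone, hence also after es has fired.
module Submission where

open import Defs
open import Data.Nat using (ℕ)
open import Data.Fin using (Fin)
open import Data.Fin.Subset using (Subset; _∈_; _∪_; _⊆_; ⁅_⁆)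
open import Data.Fin.Subset.Properties
  using (p⊆p∪q; q⊆p∪q; x∈p∪q⁻; x∈p∪q⁺; ∪⇔⊎; ⊥⊆; ⊆-refl)
open import Data.List using (List; []; _∷_; _++_)
import Data.List.Membership.Propositional as List
open import Data.List.Membership.Propositional.Properties using (++-∈⇔)
open import Data.Product using (_,_)
open import Data.Sum using (inj₁; inj₂)
open import Data.Sum.Function.Propositional using (_⊎-⇔_)
open import Data.Unit using (tt)
open import Function.Bundles using (_⇔_)
import Function.Properties.Equivalence as ⇔

∪-monoʳ-⊆ : ∀ {n} (p : Subset n) {q q′ : Subset n} → q ⊆ q′ → p ∪ q ⊆ p ∪ q′
∪-monoʳ-⊆ p {q} q⊆q′ x∈p∪q with x∈p∪q⁻ p q x∈p∪q
... | inj₁ x∈p = x∈p∪q⁺ (inj₁ x∈p)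
... | inj₂ x∈q = x∈p∪q⁺ {p = p} (inj₂ (q⊆q′ x∈q))

Enumerates : ∀ {n} → List (Fin n) → Subset n → Set
Enumerates es C = ∀ e → (e List.∈ es) ⇔ (e ∈ C)

enumerates-++ : ∀ {n} {C D : Subset n} (es ds : List (Fin n)) →
  Enumerates es C → Enumerates ds D → Enumerates (es ++ ds) (C ∪ D)
enumerates-++ {C = C} {D} es ds es≡C ds≡D e =
  ⇔.trans (++-∈⇔ {xs = es})
    (⇔.trans (es≡C e ⊎-⇔ ds≡D e) (⇔.sym (∪⇔⊎ {p = C} {q = D})))

module _ {n m : ℕ} (𝒞 : Contract n m) where
  open Contract 𝒞

  -- The set of events fired after running es, starting from the prefix P;
  -- this is the accumulator ValidFrom reaches at the end of es.
  firedAfter : Subset n → List (Fin n) → Subset n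
  firedAfter P []       = P
  firedAfter P (e ∷ es) = firedAfter (⁅ e ⁆ ∪ P) es

  validFrom-weaken : ∀ {C C′ P P′} es → C ⊆ C′ → P ⊆ P′ →
    ValidFrom 𝒞 C es P → ValidFrom 𝒞 C′ es P′
  validFrom-weaken []       C⊆C′ P⊆P′ tt = tt
  validFrom-weaken (e ∷ es) C⊆C′ P⊆P′ (inj₁ P⊢e , rest) =
    inj₁ (⊢-sat P⊢e P⊆P′) , validFrom-weaken es C⊆C′ (∪-monoʳ-⊆ ⁅ e ⁆ P⊆P′) rest
  validFrom-weaken (e ∷ es) C⊆C′ P⊆P′ (inj₂ C⊩e , rest) =
    inj₂ (⊩-sat C⊩e C⊆C′) , validFrom-weaken es C⊆C′ (∪-monoʳ-⊆ ⁅ e ⁆ P⊆P′) rest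

  validFrom-++ : ∀ {C P} es ds → ValidFrom 𝒞 C es P →
    ValidFrom 𝒞 C ds (firedAfter P es) → ValidFrom 𝒞 C (es ++ ds) P
  validFrom-++ []       ds tt               valid-ds = valid-ds
  validFrom-++ (e ∷ es) ds (enabled , rest) valid-ds =
    enabled , validFrom-++ es ds rest valid-ds

-- Concatenate the two witnessing runs; the run for D is valid after that
-- for C because it starts from the empty prefix, which is below anything.
lemma1 : ∀ {n m : ℕ} (𝒞 : Contract n m) (C D : Subset n) →
    IsConfiguration 𝒞 C → IsConfiguration 𝒞 D → IsConfiguration 𝒞 (C ∪ D)
lemma1 𝒞 C D (es , es≡C , valid-es) (ds , ds≡D , valid-ds) =
  es ++ ds ,
  enumerates-++ es ds es≡C ds≡D ,
  validFrom-++ 𝒞 es ds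
    (validFrom-weaken 𝒞 es (p⊆p∪q D) ⊆-refl valid-es)
    (validFrom-weaken 𝒞 ds (q⊆p∪q C D) ⊥⊆ valid-ds)
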